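{- Let $p$ be an odd prime. Then there are no positive integers $a>b$ with $a\not\equiv 0 \pmod p$ such that \[\binom{an}{bn}\equiv 0 \pmod{pn-1}\] for all integers $n\geq 1$. -}

-- Some prime factor q of a! p − 1 ≡ −1 (mod p) has a power
-- q ^ L ≡ −1 (mod p): otherwise every prime factor has an odd power ≡ 1, and then so would a! p − 1.
-- Also q > a. Put t = 1, k = L if b mod p ≤ a mod p, and otherwise t = p − 1, k = 2 L (this is where
-- p ∤ a enters). Then n = (1 + t q^k) / p is an integer and q^k ∣ p n − 1 ∣ C(a n, b n). But for x ≤ a
-- one has ⌊x n / q^k⌋ = ⌊x t / p⌋ < q, so adding b n and (a − b) n in base q produces no carry at
-- digit k (as b t mod p ≤ a t mod p) nor above it; by Legendre's formula the exponent of q in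
-- C(a n, b n) is therefore at most k − 1.
module Submission where

open import Data.Fin using (Fin; toℕ; fromℕ<)
open import Data.Fin.Properties using (pigeonhole; toℕ-fromℕ<)
open import Data.List using ([]; _∷_)
open import Data.List.Relation.Unary.All using (All; []; _∷_)
open import Data.Nat
open import Data.Nat.Combinatorics using (_C_; nCk≡n!/k![n-k]!; k![n∸k]!∣n!)
open import Data.Nat.Divisibility
open import Data.Nat.DivMod
open import Data.Nat.ListAction using (product)
open import Data.Nat.Primality using (Prime; euclidsLemma; prime⇒nonZero; prime⇒nonTrivial)
open import Data.Nat.Primality.Factorisation using (factorise)
open import Data.Nat.Properties
open import Data.Nat.Tactic.RingSolver using (solve-∀)
open import Data.Product using (_×_; _,_; ∃-syntax)
open import Data.Sum using (_⊎_; inj₁; inj₂)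
open import Relation.Binary.PropositionalEquality
open import Relation.Nullary using (¬_; yes; no; contradiction)

/-suc : ∀ m d .{{_ : NonZero d}} → suc m ≡ suc (m / d) * d ⊎ (suc m / d ≡ m / d × d ∤ suc m)
/-suc m d with m≤n⇒m<n∨m≡n (m%n<n m d)
... | inj₂ 1+m%d≡d = inj₁ (begin
  suc m                   ≡⟨ cong suc (m≡m%n+[m/n]*n m d) ⟩
  suc (m % d) + m / d * d ≡⟨ cong (_+ m / d * d) 1+m%d≡d ⟩
  d + m / d * d           ∎)
  where open ≡-Reasoning
... | inj₁ 1+m%d<d = inj₂ (quotient≡ , λ d∣1+m → 0≢1+n (trans (sym (n∣m⇒m%n≡0 _ d d∣1+m)) remainder≡))
  where
  open ≡-Reasoning
  1+m≡ : suc m ≡ suc (m % d) + m / d * d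
  1+m≡ = cong suc (m≡m%n+[m/n]*n m d)
  quotient≡ : suc m / d ≡ m / d
  quotient≡ = begin
    suc m / d                         ≡⟨ /-congˡ 1+m≡ ⟩
    (suc (m % d) + m / d * d) / d     ≡⟨ +-distrib-/-∣ʳ (suc (m % d)) (divides-refl (m / d)) ⟩
    suc (m % d) / d + m / d * d / d   ≡⟨ cong₂ _+_ (m<n⇒m/n≡0 1+m%d<d) (m*n/n≡m (m / d) d) ⟩
    m / d                             ∎
  remainder≡ : suc m % d ≡ suc (m % d)
  remainder≡ = begin
    suc m % d                     ≡⟨ %-congˡ 1+m≡ ⟩
    (suc (m % d) + m / d * d) % d ≡⟨ [m+kn]%n≡m%n (suc (m % d)) (m / d) d ⟩
    suc (m % d) % d               ≡⟨ m<n⇒m%n≡m 1+m%d<d ⟩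
    suc (m % d)                   ∎

m≤n+o+1⇒m/d≤n/d+o/d+1 : ∀ {m n o} d .{{_ : NonZero d}} → m ≤ n + o + 1 → m / d ≤ n / d + o / d + 1
m≤n+o+1⇒m/d≤n/d+o/d+1 {m} {n} {o} d m≤n+o+1 = s≤s⁻¹ (*-cancelʳ-< d _ _ (begin-strict
  m / d * d                                     ≤⟨ m/n*n≤m m d ⟩
  m                                             ≤⟨ m≤n+o+1 ⟩
  n + o + 1                                     ≡⟨ cong₂ (λ n o → n + o + 1) (m≡m%n+[m/n]*n n d) (m≡m%n+[m/n]*n o d) ⟩
  (n % d + n / d * d) + (o % d + o / d * d) + 1 ≡⟨ regroup (n % d) (o % d) (n / d) (o / d) d ⟩
  (suc (n % d) + o % d) + (n / d + o / d) * d   <⟨ +-monoˡ-< _ (+-mono-≤-< (m%n<n n d) (m%n<n o d)) ⟩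
  (d + d) + (n / d + o / d) * d                 ≡⟨ regroup′ (n / d + o / d) d ⟩
  suc (n / d + o / d + 1) * d                   ∎))
  where
  open ≤-Reasoning
  regroup : ∀ a b c e d → (a + c * d) + (b + e * d) + 1 ≡ (suc a + b) + (c + e) * d
  regroup = solve-∀
  regroup′ : ∀ c d → (d + d) + c * d ≡ suc (c + 1) * d
  regroup′ = solve-∀

m%d≤[m+n]%d⇒[m+n]/d≡m/d+n/d : ∀ {m n} d .{{_ : NonZero d}} → m % d ≤ (m + n) % d → (m + n) / d ≡ m / d + n / d
m%d≤[m+n]%d⇒[m+n]/d≡m/d+n/d {m} {n} d noCarry = +-distrib-/ m n remainders<d
  where
  remainders<d : m % d + n % d < d
  remainders<d with m % d + n % d <? d
  ... | yes lt = lt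
  ... | no nlt = contradiction noCarry (<⇒≱ (begin-strict
      (m + n) % d             ≡⟨ %-distribˡ-+ m n d ⟩
      (m % d + n % d) % d     ≡⟨ m≤n⇒[n∸m]%m≡n%m d≤sum ⟨
      (m % d + n % d ∸ d) % d ≤⟨ m%n≤m _ d ⟩
      m % d + n % d ∸ d       <⟨ ∸-monoˡ-< (+-monoʳ-< (m % d) (m%n<n n d)) d≤sum ⟩
      m % d + d ∸ d           ≡⟨ m+n∸n≡m (m % d) d ⟩
      m % d                   ∎))
    where
    open ≤-Reasoning
    d≤sum : d ≤ m % d + n % d
    d≤sum = ≮⇒≥ nlt

-- p x n = x + x t Q; with E = x + (x t mod p) Q, which p divides, x n = E / p + ⌊x t / p⌋ Q
-- and E / p < Q.
pn≡1+tQ⇒xn/Q≡xt/p : ∀ {p Q n t} x .{{_ : NonZero p}} .{{_ : NonZero Q}} →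
                    p * n ≡ 1 + t * Q → x < Q → x * n / Q ≡ x * t / p
pn≡1+tQ⇒xn/Q≡xt/p {p} {Q} {n} {t} x pn≡1+tQ x<Q = begin
  x * n / Q              ≡⟨ /-congˡ xn≡e+sQ ⟩
  (e + s * Q) / Q        ≡⟨ +-distrib-/-∣ʳ e (divides-refl s) ⟩
  e / Q + s * Q / Q      ≡⟨ cong₂ _+_ (m<n⇒m/n≡0 e<Q) (m*n/n≡m s Q) ⟩
  s                      ∎
  where
  open ≡-Reasoning
  s = x * t / p
  E = x + x * t % p * Q
  regroup : ∀ x r s p Q → x + (r + s * p) * Q ≡ (x + r * Q) + p * (s * Q)
  regroup = solve-∀
  swap : ∀ p x n → p * (x * n) ≡ x * (p * n)
  swap = solve-∀
  expand : ∀ x t Q → x * (1 + t * Q) ≡ x + x * t * Q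
  expand = solve-∀
  p[xn]≡E+p[sQ] : p * (x * n) ≡ E + p * (s * Q)
  p[xn]≡E+p[sQ] = begin
    p * (x * n)                                  ≡⟨ swap p x n ⟩
    x * (p * n)                                  ≡⟨ cong (x *_) pn≡1+tQ ⟩
    x * (1 + t * Q)                              ≡⟨ expand x t Q ⟩
    x + x * t * Q                                ≡⟨ cong (λ y → x + y * Q) (m≡m%n+[m/n]*n (x * t) p) ⟩
    x + (x * t % p + s * p) * Q                  ≡⟨ regroup x (x * t % p) s p Q ⟩
    E + p * (s * Q)                              ∎
  e = E / p
  pe≡E : p * e ≡ E
  pe≡E = m*[n/m]≡n (∣m+n∣m⇒∣n (subst (p ∣_) (trans p[xn]≡E+p[sQ] (+-comm E _)) (m∣m*n (x * n))) (m∣m*n (s * Q)))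
  xn≡e+sQ : x * n ≡ e + s * Q
  xn≡e+sQ = *-cancelˡ-≡ _ _ p (begin
    p * (x * n)       ≡⟨ p[xn]≡E+p[sQ] ⟩
    E + p * (s * Q)   ≡⟨ cong (_+ p * (s * Q)) pe≡E ⟨
    p * e + p * (s * Q) ≡⟨ *-distribˡ-+ p e (s * Q) ⟨
    p * (e + s * Q)   ∎)
  e<Q : e < Q
  e<Q = *-cancelˡ-< p e Q (subst (_< p * Q) (sym pe≡E)
    (<-≤-trans (+-monoˡ-< _ x<Q) (*-monoˡ-≤ Q (m%n<n (x * t) p))))

m^n∣m^o : ∀ m {n o} → n ≤ o → m ^ n ∣ m ^ o
m^n∣m^o m {n} {o} n≤o = divides (m ^ (o ∸ n))
  (trans (cong (m ^_) (sym (m∸n+n≡m n≤o))) (^-distribˡ-+-* m (o ∸ n) n))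

^-distribʳ-* : ∀ m n o → (m * n) ^ o ≡ m ^ o * n ^ o
^-distribʳ-* m n zero    = refl
^-distribʳ-* m n (suc o) = trans (cong (m * n *_) (^-distribʳ-* m n o)) (interchange m n (m ^ o) (n ^ o))
  where
  interchange : ∀ a b c d → a * b * (c * d) ≡ a * c * (b * d)
  interchange = solve-∀

n∣n! : ∀ n .{{_ : NonZero n}} → n ∣ n !
n∣n! (suc n) = m∣m*n (n !)

even-or-odd : ∀ n → ∃[ w ] (n ≡ w + w ⊎ n ≡ suc (w + w))
even-or-odd zero = 0 , inj₁ refl
even-or-odd (suc n) with even-or-odd n
... | w , inj₁ n≡w+w     = w , inj₂ (cong suc n≡w+w)
... | w , inj₂ n≡1+w+w   = suc w , inj₁ (cong suc (trans n≡1+w+w (sym (+-suc w w))))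

module _ {p : ℕ} (p-prime : Prime p) where
  private instance
    p≢0 : NonZero p
    p≢0 = prime⇒nonZero p-prime

  1<p : 1 < p
  1<p = nonTrivial⇒n>1 p {{prime⇒nonTrivial p-prime}}

  prime∤1 : p ∤ 1
  prime∤1 = >⇒∤ 1<p

  prime∤* : ∀ {m n} → p ∤ m → p ∤ n → p ∤ m * n
  prime∤* {m} {n} p∤m p∤n p∣mn with euclidsLemma m n p-prime p∣mn
  ... | inj₁ p∣m = p∤m p∣m
  ... | inj₂ p∣n = p∤n p∣n

  prime∤^ : ∀ {m} → p ∤ m → ∀ n → p ∤ m ^ n
  prime∤^ p∤m zero    = prime∤1
  prime∤^ p∤m (suc n) = prime∤* p∤m (prime∤^ p∤m n)

  prime∤! : ∀ {m} → m < p → p ∤ m !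
  prime∤! {zero}  _     = prime∤1
  prime∤! {suc m} 1+m<p = prime∤* (>⇒∤ 1+m<p) (prime∤! (<⇒≤ 1+m<p))

module Legendre {q : ℕ} (q-prime : Prime q) where
  private instance
    q≢0 : NonZero q
    q≢0 = prime⇒nonZero q-prime

  ⌊_/q^_⌋ : ℕ → ℕ → ℕ
  ⌊ m /q^ zero  ⌋ = m
  ⌊ m /q^ suc d ⌋ = ⌊ m / q /q^ d ⌋

  ⌊m/q^d⌋≡m/q^d : ∀ m d → ⌊ m /q^ d ⌋ ≡ (m / q ^ d) {{m^n≢0 q d}}
  ⌊m/q^d⌋≡m/q^d m zero    = sym (n/1≡n m)
  ⌊m/q^d⌋≡m/q^d m (suc d) = trans (⌊m/q^d⌋≡m/q^d (m / q) d)
    (m/n/o≡m/[n*o] m q (q ^ d) {{_}} {{m^n≢0 q d}} {{m^n≢0 q (suc d)}})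

  ⌊/q^⌋-monoˡ-≤ : ∀ {m n} d → m ≤ n → ⌊ m /q^ d ⌋ ≤ ⌊ n /q^ d ⌋
  ⌊/q^⌋-monoˡ-≤ zero    m≤n = m≤n
  ⌊/q^⌋-monoˡ-≤ (suc d) m≤n = ⌊/q^⌋-monoˡ-≤ d (/-monoˡ-≤ q m≤n)

  legendre : ℕ → ℕ → ℕ
  legendre m zero    = 0
  legendre m (suc d) = m / q + legendre (m / q) d

  !≡q^[m/q]*[m/q]!*unit : ∀ m → ∃[ u ] (q ∤ u × m ! ≡ q ^ (m / q) * (m / q) ! * u)
  !≡q^[m/q]*[m/q]!*unit zero = 1 , prime∤1 q-prime , cong (λ k → q ^ k * k ! * 1) (sym (0/n≡0 q))
  !≡q^[m/q]*[m/q]!*unit (suc m) with !≡q^[m/q]*[m/q]!*unit m | /-suc m q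
  ... | u , q∤u , m!≡ | inj₂ (1+m/q≡m/q , q∤1+m) =
    suc m * u , prime∤* q-prime q∤1+m q∤u , (begin
      suc m * m !                                   ≡⟨ cong (suc m *_) m!≡ ⟩
      suc m * (q ^ (m / q) * (m / q) ! * u)         ≡⟨ reorder (suc m) (q ^ (m / q)) ((m / q) !) u ⟩
      q ^ (m / q) * (m / q) ! * (suc m * u)         ≡⟨ cong (λ k → q ^ k * k ! * (suc m * u)) 1+m/q≡m/q ⟨
      q ^ (suc m / q) * (suc m / q) ! * (suc m * u) ∎)
    where
    open ≡-Reasoning
    reorder : ∀ s x y u → s * (x * y * u) ≡ x * y * (s * u)
    reorder = solve-∀
  ... | u , q∤u , m!≡ | inj₁ 1+m≡[1+m/q]q = u , q∤u , (begin
      suc m * m !                                    ≡⟨ cong₂ _*_ 1+m≡[1+m/q]q m!≡ ⟩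
      suc (m / q) * q * (q ^ (m / q) * (m / q) ! * u) ≡⟨ reorder (suc (m / q)) q (q ^ (m / q)) ((m / q) !) u ⟩
      q ^ suc (m / q) * suc (m / q) ! * u           ≡⟨ cong (λ k → q ^ k * k ! * u) 1+m/q≡1+[m/q] ⟨
      q ^ (suc m / q) * (suc m / q) ! * u           ∎)
    where
    open ≡-Reasoning
    1+m/q≡1+[m/q] : suc m / q ≡ suc (m / q)
    1+m/q≡1+[m/q] = trans (/-congˡ 1+m≡[1+m/q]q) (m*n/n≡m (suc (m / q)) q)
    reorder : ∀ s q x y u → s * q * (x * y * u) ≡ q * x * (s * y) * u
    reorder = solve-∀

  !≡q^legendre*unit : ∀ d m → ⌊ m /q^ d ⌋ < q → ∃[ u ] (q ∤ u × m ! ≡ q ^ legendre m d * u)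
  !≡q^legendre*unit zero    m m<q = m ! , prime∤! q-prime m<q , sym (*-identityˡ (m !))
  !≡q^legendre*unit (suc d) m top<q
    with u , q∤u , m!≡ ← !≡q^[m/q]*[m/q]!*unit m
       | v , q∤v , [m/q]!≡ ← !≡q^legendre*unit d (m / q) top<q
    = v * u , prime∤* q-prime q∤v q∤u , (begin
      m !                                              ≡⟨ m!≡ ⟩
      q ^ (m / q) * (m / q) ! * u                      ≡⟨ cong (λ k → q ^ (m / q) * k * u) [m/q]!≡ ⟩
      q ^ (m / q) * (q ^ legendre (m / q) d * v) * u   ≡⟨ reorder (q ^ (m / q)) _ v u ⟩
      q ^ (m / q) * q ^ legendre (m / q) d * (v * u)   ≡⟨ cong (_* (v * u)) (^-distribˡ-+-* q (m / q) _) ⟨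
      q ^ legendre m (suc d) * (v * u)                 ∎)
    where
    open ≡-Reasoning
    reorder : ∀ a b c d → a * (b * c) * d ≡ (a * b) * (c * d)
    reorder = solve-∀

  -- Kummer: at most one carry at each of the levels 1, …, d, and none at level d + 1.
  legendre-carries : ∀ d {N M R} → N ≤ M + R + 1 →
                     ⌊ N /q^ suc d ⌋ ≤ ⌊ M /q^ suc d ⌋ + ⌊ R /q^ suc d ⌋ →
                     legendre N (suc d) + 1 ≤ legendre M (suc d) + legendre R (suc d) + suc d
  legendre-carries zero {N} {M} {R} _ noCarry
    rewrite +-identityʳ (N / q) | +-identityʳ (M / q) | +-identityʳ (R / q) = +-monoˡ-≤ 1 noCarry
  legendre-carries (suc d) {N} {M} {R} N≤M+R+1 noCarry = begin
    N / q + legendre (N / q) (suc d) + 1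
      ≡⟨ +-assoc (N / q) _ 1 ⟩
    N / q + (legendre (N / q) (suc d) + 1)
      ≤⟨ +-mono-≤ N/q≤ (legendre-carries d N/q≤ noCarry) ⟩
    (M / q + R / q + 1) + (legendre (M / q) (suc d) + legendre (R / q) (suc d) + suc d)
      ≡⟨ regroup (M / q) (R / q) _ _ d ⟩
    (M / q + legendre (M / q) (suc d)) + (R / q + legendre (R / q) (suc d)) + suc (suc d) ∎
    where
    open ≤-Reasoning
    N/q≤ : N / q ≤ M / q + R / q + 1
    N/q≤ = m≤n+o+1⇒m/d≤n/d+o/d+1 q N≤M+R+1
    regroup : ∀ a b c d e → (a + b + 1) + (c + d + suc e) ≡ (a + c) + (b + d) + suc (suc e)
    regroup = solve-∀

  q^k∤NCM : ∀ {k N M} → 0 < k → M ≤ N → ⌊ N /q^ k ⌋ < q →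
          ⌊ N /q^ k ⌋ ≤ ⌊ M /q^ k ⌋ + ⌊ N ∸ M /q^ k ⌋ → q ^ k ∤ N C M
  q^k∤NCM {suc d} {N} {M} _ M≤N top<q noCarry q^k∣C
    with u , q∤u , N!≡ ← !≡q^legendre*unit (suc d) N top<q
       | v , _ , M!≡ ← !≡q^legendre*unit (suc d) M (≤-<-trans (⌊/q^⌋-monoˡ-≤ (suc d) M≤N) top<q)
       | w , _ , R!≡ ← !≡q^legendre*unit (suc d) (N ∸ M) (≤-<-trans (⌊/q^⌋-monoˡ-≤ (suc d) (m∸n≤m N M)) top<q)
    = q∤u (*-cancelˡ-∣ (q ^ νN) {{m^n≢0 q νN}} q^νN*q∣q^νN*u)
    where
    k = suc d
    R = N ∸ M
    νN = legendre N k
    νM = legendre M k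
    νR = legendre R k
    C*M!*R!≡N! : (N C M) * (M ! * R !) ≡ N !
    C*M!*R!≡N! = trans (cong (_* (M ! * R !)) (nCk≡n!/k![n-k]! M≤N))
                       (m/n*n≡m {{M !* R !≢0}} (k![n∸k]!∣n! M≤N))
    q^[k+νM+νR]∣N! : q ^ k * (q ^ νM * q ^ νR) ∣ N !
    q^[k+νM+νR]∣N! = subst (q ^ k * (q ^ νM * q ^ νR) ∣_) C*M!*R!≡N! (*-pres-∣ q^k∣C (*-pres-∣
      (subst (q ^ νM ∣_) (sym M!≡) (m∣m*n v)) (subst (q ^ νR ∣_) (sym R!≡) (m∣m*n w))))
    powers : q ^ k * (q ^ νM * q ^ νR) ≡ q ^ (νM + νR + k)
    powers = begin
      q ^ k * (q ^ νM * q ^ νR) ≡⟨ cong (q ^ k *_) (^-distribˡ-+-* q νM νR) ⟨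
      q ^ k * q ^ (νM + νR)     ≡⟨ ^-distribˡ-+-* q k (νM + νR) ⟨
      q ^ (k + (νM + νR))       ≡⟨ cong (q ^_) (+-comm k (νM + νR)) ⟩
      q ^ (νM + νR + k)         ∎
      where open ≡-Reasoning
    N≤M+R+1 : N ≤ M + R + 1
    N≤M+R+1 = ≤-trans (≤-reflexive (sym (m+[n∸m]≡n M≤N))) (m≤m+n (M + R) 1)
    q^[νN+1]∣N! : q ^ (νN + 1) ∣ N !
    q^[νN+1]∣N! = ∣-trans (m^n∣m^o q (legendre-carries d N≤M+R+1 noCarry))
                          (subst (_∣ N !) powers q^[k+νM+νR]∣N!)
    q^νN*q∣q^νN*u : q ^ νN * q ∣ q ^ νN * u
    q^νN*q∣q^νN*u = subst₂ _∣_ (trans (^-distribˡ-+-* q νN 1) (cong (q ^ νN *_) (*-identityʳ q))) N!≡ q^[νN+1]∣N!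

q^k∤[an]C[bn] : ∀ {p q t k a b n} .{{_ : NonZero p}} → Prime q → 0 < k → b < a → a < q → t ≤ p →
                p * n ≡ 1 + t * q ^ k → b * t % p ≤ a * t % p → q ^ k ∤ (a * n) C (b * n)
q^k∤[an]C[bn] {p} {q} {t} {suc d} {a} {b} {n} q-prime 0<k b<a a<q t≤p pn≡1+tqᵏ noCarry =
  q^k∤NCM 0<k (*-monoˡ-≤ n b≤a) (subst (_< q) (sym (top≡ ≤-refl)) (xt/p<q ≤-refl)) (≤-reflexive top-no-carry)
  where
  open Legendre q-prime
  instance
    q^d≢0 : NonZero (q ^ d)
    q^d≢0 = m^n≢0 q d {{prime⇒nonZero q-prime}}
    q^k≢0 : NonZero (q ^ suc d)
    q^k≢0 = m^n≢0 q (suc d) {{prime⇒nonZero q-prime}}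
  k = suc d
  c = a ∸ b
  b≤a : b ≤ a
  b≤a = <⇒≤ b<a
  top≡ : ∀ {x} → x ≤ a → ⌊ x * n /q^ k ⌋ ≡ x * t / p
  top≡ {x} x≤a = trans (⌊m/q^d⌋≡m/q^d (x * n) k)
    (pn≡1+tQ⇒xn/Q≡xt/p x pn≡1+tqᵏ (<-≤-trans (≤-<-trans x≤a a<q) (m≤m*n q (q ^ d))))
  xt/p<q : ∀ {x} → x ≤ a → x * t / p < q
  xt/p<q {x} x≤a = ≤-<-trans (≤-trans (/-monoˡ-≤ p (*-monoʳ-≤ x t≤p)) (≤-reflexive (m*n/n≡m x p)))
                             (≤-<-trans x≤a a<q)
  at≡bt+ct : a * t ≡ b * t + c * t
  at≡bt+ct = trans (cong (_* t) (sym (m+[n∸m]≡n b≤a))) (*-distribʳ-+ t b c)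
  top-no-carry : ⌊ a * n /q^ k ⌋ ≡ ⌊ b * n /q^ k ⌋ + ⌊ a * n ∸ b * n /q^ k ⌋
  top-no-carry = begin
    ⌊ a * n /q^ k ⌋                           ≡⟨ top≡ ≤-refl ⟩
    a * t / p                                 ≡⟨ /-congˡ at≡bt+ct ⟩
    (b * t + c * t) / p                       ≡⟨ m%d≤[m+n]%d⇒[m+n]/d≡m/d+n/d p (subst (λ y → b * t % p ≤ y % p) at≡bt+ct noCarry) ⟩
    b * t / p + c * t / p                     ≡⟨ cong₂ _+_ (top≡ b≤a) (top≡ (m∸n≤m a b)) ⟨
    ⌊ b * n /q^ k ⌋ + ⌊ c * n /q^ k ⌋         ≡⟨ cong (λ y → ⌊ b * n /q^ k ⌋ + ⌊ y /q^ k ⌋) (*-distribʳ-∸ n a b) ⟩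
    ⌊ b * n /q^ k ⌋ + ⌊ a * n ∸ b * n /q^ k ⌋ ∎
    where open ≡-Reasoning

∃n[pn∸1∤[an]C[bn]] : ∀ {p q t k a b} .{{_ : NonZero p}} → Prime q → 0 < k → b < a → a < q → t ≤ p →
                     p ∣ 1 + t * q ^ k → b * t % p ≤ a * t % p →
                     ∃[ n ] (1 ≤ n × p * n ∸ 1 ∤ (a * n) C (b * n))
∃n[pn∸1∤[an]C[bn]] {p} {q} {t} {k} {a} {b} q-prime 0<k b<a a<q t≤p p∣1+tqᵏ noCarry =
  n , 1≤n , λ pn∸1∣C → q^k∤[an]C[bn] q-prime 0<k b<a a<q t≤p pn≡1+tqᵏ noCarry
                         (∣-trans (n∣m*n t) (subst (_∣ (a * n) C (b * n)) (cong (_∸ 1) pn≡1+tqᵏ) pn∸1∣C))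
  where
  n = (1 + t * q ^ k) / p
  pn≡1+tqᵏ : p * n ≡ 1 + t * q ^ k
  pn≡1+tqᵏ = m*[n/m]≡n p∣1+tqᵏ
  1≤n : 1 ≤ n
  1≤n = n≢0⇒n>0 λ n≡0 → 0≢1+n (trans (sym (*-zeroʳ p)) (trans (cong (p *_) (sym n≡0)) pn≡1+tqᵏ))

module OddPrime {p : ℕ} (p-prime : Prime p) (2<p : 2 < p) where
  private instance
    p≢0 : NonZero p
    p≢0 = prime⇒nonZero p-prime

  infix 4 _≡ₚ_
  _≡ₚ_ : ℕ → ℕ → Set
  x ≡ₚ y = x % p ≡ y % p

  ≡ₚ-+ : ∀ {x x′ y y′} → x ≡ₚ x′ → y ≡ₚ y′ → x + y ≡ₚ x′ + y′
  ≡ₚ-+ {x} {x′} {y} {y′} x≡x′ y≡y′ = begin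
    (x + y) % p               ≡⟨ %-distribˡ-+ x y p ⟩
    (x % p + y % p) % p       ≡⟨ cong₂ (λ u v → (u + v) % p) x≡x′ y≡y′ ⟩
    (x′ % p + y′ % p) % p     ≡⟨ %-distribˡ-+ x′ y′ p ⟨
    (x′ + y′) % p             ∎
    where open ≡-Reasoning

  ≡ₚ-* : ∀ {x x′ y y′} → x ≡ₚ x′ → y ≡ₚ y′ → x * y ≡ₚ x′ * y′
  ≡ₚ-* {x} {x′} {y} {y′} x≡x′ y≡y′ = begin
    x * y % p                 ≡⟨ %-distribˡ-* x y p ⟩
    (x % p) * (y % p) % p     ≡⟨ cong₂ (λ u v → u * v % p) x≡x′ y≡y′ ⟩
    (x′ % p) * (y′ % p) % p   ≡⟨ %-distribˡ-* x′ y′ p ⟨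
    x′ * y′ % p               ∎
    where open ≡-Reasoning

  ≡ₚ-^ : ∀ {x y} n → x ≡ₚ y → x ^ n ≡ₚ y ^ n
  ≡ₚ-^ zero    _   = refl
  ≡ₚ-^ (suc n) x≡y = ≡ₚ-* x≡y (≡ₚ-^ n x≡y)

  ≡ₚ⇒∣∸ : ∀ {x y} → y ≤ x → x ≡ₚ y → p ∣ x ∸ y
  ≡ₚ⇒∣∸ {x} {y} y≤x x≡y = divides (x / p ∸ y / p) (begin
    x ∸ y                                     ≡⟨ cong₂ _∸_ (m≡m%n+[m/n]*n x p) (m≡m%n+[m/n]*n y p) ⟩
    (x % p + x / p * p) ∸ (y % p + y / p * p) ≡⟨ cong (λ z → (x % p + x / p * p) ∸ (z + y / p * p)) x≡y ⟨
    (x % p + x / p * p) ∸ (x % p + y / p * p) ≡⟨ [m+n]∸[m+o]≡n∸o (x % p) _ _ ⟩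
    x / p * p ∸ y / p * p                     ≡⟨ *-distribʳ-∸ p (x / p) (y / p) ⟨
    (x / p ∸ y / p) * p                       ∎)
    where open ≡-Reasoning

  ∣∸⇒≡ₚ : ∀ {x y} → y ≤ x → p ∣ x ∸ y → x ≡ₚ y
  ∣∸⇒≡ₚ {x} {y} y≤x p∣x∸y = trans (cong (_% p) (sym (m+[n∸m]≡n y≤x))) (%-remove-+ʳ y p∣x∸y)

  *-cancelˡ-≡ₚ-≥ : ∀ {x y z} → p ∤ x → z ≤ y → x * y ≡ₚ x * z → y ≡ₚ z
  *-cancelˡ-≡ₚ-≥ {x} {y} {z} p∤x z≤y xy≡xz with euclidsLemma x (y ∸ z) p-prime
    (subst (p ∣_) (sym (*-distribˡ-∸ x y z)) (≡ₚ⇒∣∸ (*-monoʳ-≤ x z≤y) xy≡xz))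
  ... | inj₁ p∣x   = contradiction p∣x p∤x
  ... | inj₂ p∣y∸z = ∣∸⇒≡ₚ z≤y p∣y∸z

  *-cancelˡ-≡ₚ : ∀ {x y z} → p ∤ x → x * y ≡ₚ x * z → y ≡ₚ z
  *-cancelˡ-≡ₚ {x} {y} {z} p∤x xy≡xz with ≤-total z y
  ... | inj₁ z≤y = *-cancelˡ-≡ₚ-≥ p∤x z≤y xy≡xz
  ... | inj₂ y≤z = sym (*-cancelˡ-≡ₚ-≥ p∤x y≤z (sym xy≡xz))

  2+[p∸2]≡p : 2 + (p ∸ 2) ≡ p
  2+[p∸2]≡p = m+[n∸m]≡n (<⇒≤ 2<p)

  p∸1≡1+[p∸2] : p ∸ 1 ≡ suc (p ∸ 2)
  p∸1≡1+[p∸2] = cong (_∸ 1) (sym 2+[p∸2]≡p)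

  1+[p∸1]≡p : suc (p ∸ 1) ≡ p
  1+[p∸1]≡p = trans (cong suc p∸1≡1+[p∸2]) 2+[p∸2]≡p

  [p∸1]%p≡p∸1 : (p ∸ 1) % p ≡ p ∸ 1
  [p∸1]%p≡p∸1 = m<n⇒m%n≡m (subst (p ∸ 1 <_) 1+[p∸1]≡p ≤-refl)

  1≢ₚp∸1 : ¬ 1 ≡ₚ p ∸ 1
  1≢ₚp∸1 1≡-1 = <-irrefl 2≡p 2<p
    where
    2≡p : 2 ≡ p
    2≡p = trans (cong suc (trans (sym (m<n⇒m%n≡m (1<p p-prime))) (trans 1≡-1 [p∸1]%p≡p∸1))) 1+[p∸1]≡p

  ≡ₚp∸1⇒p∣1+ : ∀ {x} → x ≡ₚ p ∸ 1 → p ∣ 1 + x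
  ≡ₚp∸1⇒p∣1+ {x} x≡-1 = m%n≡0⇒n∣m (1 + x) p (begin
    (1 + x) % p       ≡⟨ ≡ₚ-+ {1} {1} refl x≡-1 ⟩
    (1 + (p ∸ 1)) % p ≡⟨ cong (_% p) 1+[p∸1]≡p ⟩
    p % p             ≡⟨ n%n≡0 p ⟩
    0                 ∎)
    where open ≡-Reasoning

  [p∸1]²≡ₚ1 : (p ∸ 1) * (p ∸ 1) ≡ₚ 1
  [p∸1]²≡ₚ1 = begin
    (p ∸ 1) * (p ∸ 1) % p              ≡⟨ cong (λ m → m * m % p) p∸1≡1+[p∸2] ⟩
    suc (p ∸ 2) * suc (p ∸ 2) % p      ≡⟨ cong (_% p) (square (p ∸ 2)) ⟩
    (1 + (p ∸ 2) * (2 + (p ∸ 2))) % p  ≡⟨ cong (λ m → (1 + (p ∸ 2) * m) % p) 2+[p∸2]≡p ⟩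
    (1 + (p ∸ 2) * p) % p              ≡⟨ [m+kn]%n≡m%n 1 (p ∸ 2) p ⟩
    1 % p                              ∎
    where
    open ≡-Reasoning
    square : ∀ s → suc s * suc s ≡ 1 + s * (2 + s)
    square = solve-∀

  [p∸1]^odd≡ₚp∸1 : ∀ w → (p ∸ 1) ^ suc (w + w) ≡ₚ p ∸ 1
  [p∸1]^odd≡ₚp∸1 zero    = cong (_% p) (*-identityʳ (p ∸ 1))
  [p∸1]^odd≡ₚp∸1 (suc w) = begin
    (p ∸ 1) ^ suc (suc w + suc w) % p                 ≡⟨ cong (λ e → (p ∸ 1) ^ suc e % p) (+-suc (suc w) w) ⟩
    (p ∸ 1) * ((p ∸ 1) * (p ∸ 1) ^ suc (w + w)) % p   ≡⟨ cong (_% p) (*-assoc (p ∸ 1) (p ∸ 1) _) ⟨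
    (p ∸ 1) * (p ∸ 1) * (p ∸ 1) ^ suc (w + w) % p     ≡⟨ ≡ₚ-* [p∸1]²≡ₚ1 ([p∸1]^odd≡ₚp∸1 w) ⟩
    1 * (p ∸ 1) % p                                   ≡⟨ cong (_% p) (*-identityˡ (p ∸ 1)) ⟩
    (p ∸ 1) % p                                       ∎
    where open ≡-Reasoning

  x[p∸1]%p≡p∸x%p : ∀ x → 0 < x % p → x * (p ∸ 1) % p ≡ p ∸ x % p
  x[p∸1]%p≡p∸x%p x _ with x % p in x%p≡ | m%n<n x p
  ... | suc s | 1+s<p = begin
    x * (p ∸ 1) % p       ≡⟨ ≡ₚ-* {x} {suc s} {p ∸ 1} {p ∸ 1} x≡ₚ1+s refl ⟩
    suc s * (p ∸ 1) % p   ≡⟨ cong (λ m → suc s * m % p) s+z≡p∸1 ⟨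
    suc s * (s + z) % p   ≡⟨ cong (_% p) (expand s z) ⟩
    (z + s * suc (s + z)) % p ≡⟨ cong (λ m → (z + s * m) % p) 1+s+z≡p ⟩
    (z + s * p) % p       ≡⟨ [m+kn]%n≡m%n z s p ⟩
    z % p                 ≡⟨ m<n⇒m%n≡m (∸-monoʳ-< z<s (<⇒≤ 1+s<p)) ⟩
    z                     ∎
    where
    open ≡-Reasoning
    z = p ∸ suc s
    x≡ₚ1+s : x ≡ₚ suc s
    x≡ₚ1+s = trans (sym (m%n%n≡m%n x p)) (cong (_% p) x%p≡)
    1+s+z≡p : suc (s + z) ≡ p
    1+s+z≡p = m+[n∸m]≡n (<⇒≤ 1+s<p)
    s+z≡p∸1 : s + z ≡ p ∸ 1
    s+z≡p∸1 = suc-injective (trans 1+s+z≡p (sym 1+[p∸1]≡p))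
    expand : ∀ s z → suc s * (s + z) ≡ z + s * suc (s + z)
    expand = solve-∀

  ^-period : ∀ {x} → p ∤ x → ∃[ o ] (0 < o × x ^ o ≡ₚ 1)
  ^-period {x} p∤x with pigeonhole (n<1+n p) residue
    where
    residue : Fin (suc p) → Fin p
    residue i = fromℕ< (m%n<n (x ^ toℕ i) p)
  ... | i , j , i<j , residueᵢ≡residueⱼ = period (toℕ i) (toℕ j) i<j
        (trans (sym (toℕ-fromℕ< _)) (trans (cong toℕ residueᵢ≡residueⱼ) (toℕ-fromℕ< _)))
    where
    period : ∀ i j → i < j → x ^ i ≡ₚ x ^ j → ∃[ o ] (0 < o × x ^ o ≡ₚ 1)
    period i j i<j xⁱ≡xʲ = j ∸ i , m<n⇒0<n∸m i<j , *-cancelˡ-≡ₚ (prime∤^ p-prime p∤x i) (begin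
      x ^ i * x ^ (j ∸ i) % p   ≡⟨ cong (_% p) (^-distribˡ-+-* x i (j ∸ i)) ⟨
      x ^ (i + (j ∸ i)) % p     ≡⟨ cong (λ e → x ^ e % p) (m+[n∸m]≡n (<⇒≤ i<j)) ⟩
      x ^ j % p                 ≡⟨ xⁱ≡xʲ ⟨
      x ^ i % p                 ≡⟨ cong (_% p) (*-identityʳ (x ^ i)) ⟨
      x ^ i * 1 % p             ∎)
      where open ≡-Reasoning

  y²≡ₚ1⇒y≡ₚ±1 : ∀ y → y * y ≡ₚ 1 → y ≡ₚ 1 ⊎ y ≡ₚ p ∸ 1
  y²≡ₚ1⇒y≡ₚ±1 y y²≡1 with y % p in y%p≡ | m%n<n y p
  ... | zero  | _ = contradiction (≡ₚ⇒∣∸ z≤n (trans (sym y²≡1) (≡ₚ-* y≡ₚ0 y≡ₚ0))) (prime∤1 p-prime)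
    where
    y≡ₚ0 : y ≡ₚ 0
    y≡ₚ0 = trans y%p≡ (sym (m*n%n≡0 0 p))
  ... | suc s | 1+s<p with euclidsLemma s (2 + s) p-prime p∣s[2+s]
    where
    y≡ₚ1+s : y ≡ₚ suc s
    y≡ₚ1+s = trans (sym (m%n%n≡m%n y p)) (cong (_% p) y%p≡)
    p∣s[2+s] : p ∣ s * (2 + s)
    p∣s[2+s] = subst (p ∣_) (factor s) (≡ₚ⇒∣∸ (s≤s z≤n) (trans (≡ₚ-* (sym y≡ₚ1+s) (sym y≡ₚ1+s)) y²≡1))
      where
      factor : ∀ s → s + s * suc s ≡ s * (2 + s)
      factor = solve-∀
  ...   | inj₁ p∣s = inj₁ (trans s+1≡1 (sym (m<n⇒m%n≡m (1<p p-prime))))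
    where
    s+1≡1 : suc s ≡ 1
    s+1≡1 = cong suc (trans (sym (m<n⇒m%n≡m (<-trans (n<1+n s) 1+s<p))) (n∣m⇒m%n≡0 s p p∣s))
  ...   | inj₂ p∣2+s = inj₂ (trans (suc-injective (trans (≤-antisym 1+s<p (∣⇒≤ p∣2+s)) (sym 1+[p∸1]≡p))) (sym [p∸1]%p≡p∸1))

  -- Halving an even period 2e: x ^ e squares to 1, so it is ±1, and if it is 1 then e is a smaller period.
  neg-power-or-odd-period : ∀ {x} → p ∤ x → (∃[ L ] x ^ L ≡ₚ p ∸ 1) ⊎ (∃[ w ] x ^ suc (w + w) ≡ₚ 1)
  neg-power-or-odd-period {x} p∤x with o , 0<o , xᵒ≡1 ← ^-period p∤x = halve o ≤-refl 0<o xᵒ≡1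
    where
    halve : ∀ fuel {o} → o ≤ fuel → 0 < o → x ^ o ≡ₚ 1 →
            (∃[ L ] x ^ L ≡ₚ p ∸ 1) ⊎ (∃[ w ] x ^ suc (w + w) ≡ₚ 1)
    halve zero    o≤0 0<o _ = contradiction o≤0 (<⇒≱ 0<o)
    halve (suc fuel) {o} o≤fuel 0<o xᵒ≡1 with even-or-odd o
    ... | w     , inj₂ refl = inj₂ (w , xᵒ≡1)
    ... | zero  , inj₁ refl = contradiction 0<o (<-irrefl refl)
    ... | suc w , inj₁ refl with y²≡ₚ1⇒y≡ₚ±1 (x ^ suc w) (trans (cong (_% p) (sym (^-distribˡ-+-* x (suc w) (suc w)))) xᵒ≡1)
    ...   | inj₂ xᵉ≡-1 = inj₁ (suc w , xᵉ≡-1)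
    ...   | inj₁ xᵉ≡1  = halve fuel (≤-trans (m≤n+m (suc w) w) (s≤s⁻¹ o≤fuel)) z<s xᵉ≡1

  -- (q y) ^ (m O) ≡ (-1) ^ O ≡ -1 with O odd, and q ^ (m O) ≡ 1.
  cofactor-neg-power : ∀ {q y} m w → q ^ suc (w + w) ≡ₚ 1 → (q * y) ^ m ≡ₚ p ∸ 1 →
                       y ^ (m * suc (w + w)) ≡ₚ p ∸ 1
  cofactor-neg-power {q} {y} m w qᴼ≡1 [qy]ᵐ≡-1 = begin
    y ^ (m * O) % p                  ≡⟨ cong (_% p) (*-identityˡ _) ⟨
    1 * y ^ (m * O) % p              ≡⟨ ≡ₚ-* qᵐᴼ≡1 refl ⟨
    q ^ (m * O) * y ^ (m * O) % p    ≡⟨ cong (_% p) (^-distribʳ-* q y (m * O)) ⟨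
    (q * y) ^ (m * O) % p            ≡⟨ cong (_% p) (^-*-assoc (q * y) m O) ⟨
    ((q * y) ^ m) ^ O % p            ≡⟨ ≡ₚ-^ O [qy]ᵐ≡-1 ⟩
    (p ∸ 1) ^ O % p                  ≡⟨ [p∸1]^odd≡ₚp∸1 w ⟩
    (p ∸ 1) % p                      ∎
    where
    open ≡-Reasoning
    O = suc (w + w)
    qᵐᴼ≡1 : q ^ (m * O) ≡ₚ 1
    qᵐᴼ≡1 = begin
      q ^ (m * O) % p   ≡⟨ cong (λ e → q ^ e % p) (*-comm m O) ⟩
      q ^ (O * m) % p   ≡⟨ cong (_% p) (^-*-assoc q O m) ⟨
      (q ^ O) ^ m % p   ≡⟨ ≡ₚ-^ m qᴼ≡1 ⟩
      1 ^ m % p         ≡⟨ cong (_% p) (^-zeroˡ m) ⟩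
      1 % p             ∎

  product-prime-factor-with-neg-power : ∀ qs → All Prime qs → p ∤ product qs → ∀ m → product qs ^ m ≡ₚ p ∸ 1 →
                                ∃[ q ] (Prime q × q ∣ product qs × ∃[ L ] q ^ L ≡ₚ p ∸ 1)
  product-prime-factor-with-neg-power [] _ _ m 1ᵐ≡-1 = contradiction (trans (cong (_% p) (sym (^-zeroˡ m))) 1ᵐ≡-1) 1≢ₚp∸1
  product-prime-factor-with-neg-power (q ∷ qs) (q-prime ∷ qs-prime) p∤qY m [qY]ᵐ≡-1
    with neg-power-or-odd-period (λ p∣q → p∤qY (∣-trans p∣q (m∣m*n (product qs))))
  ... | inj₁ (L , qᴸ≡-1) = q , q-prime , m∣m*n (product qs) , L , qᴸ≡-1
  ... | inj₂ (w , qᴼ≡1)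
    with q′ , q′-prime , q′∣Y , L , q′ᴸ≡-1 ← product-prime-factor-with-neg-power qs qs-prime
           (λ p∣Y → p∤qY (∣-trans p∣Y (n∣m*n q))) (m * suc (w + w)) (cofactor-neg-power {q} m w qᴼ≡1 [qY]ᵐ≡-1)
    = q′ , q′-prime , ∣-trans q′∣Y (n∣m*n q) , L , q′ᴸ≡-1

  ≡ₚp∸1⇒∤ : ∀ {x} → x ≡ₚ p ∸ 1 → p ∤ x
  ≡ₚp∸1⇒∤ {x} x≡-1 p∣x = 0≢1+n (begin
    0                   ≡⟨ n∣m⇒m%n≡0 x p p∣x ⟨
    x % p               ≡⟨ x≡-1 ⟩
    (p ∸ 1) % p         ≡⟨ [p∸1]%p≡p∸1 ⟩
    p ∸ 1               ≡⟨ p∸1≡1+[p∸2] ⟩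
    suc (p ∸ 2)         ∎)
    where open ≡-Reasoning

  prime-factor-with-neg-power : ∀ x .{{_ : NonZero x}} → x ≡ₚ p ∸ 1 →
                                ∃[ q ] (Prime q × q ∣ x × ∃[ L ] q ^ L ≡ₚ p ∸ 1)
  prime-factor-with-neg-power x x≡-1 with factorise x
  ... | record { factors = qs ; isFactorisation = x≡Πqs ; factorsPrime = qs-prime }
    with q , q-prime , q∣Πqs , L , qᴸ≡-1 ← product-prime-factor-with-neg-power qs qs-prime
           (subst (p ∤_) x≡Πqs (≡ₚp∸1⇒∤ x≡-1)) 1
           (subst (λ y → y ^ 1 ≡ₚ p ∸ 1) x≡Πqs (trans (cong (_% p) (*-identityʳ x)) x≡-1))
    = q , q-prime , subst (q ∣_) (sym x≡Πqs) q∣Πqs , L , qᴸ≡-1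

  ∃prime>-with-neg-power : ∀ a → ∃[ q ] (Prime q × a < q × ∃[ L ] q ^ L ≡ₚ p ∸ 1)
  ∃prime>-with-neg-power a = above (prime-factor-with-neg-power X ([m+kn]%n≡m%n (p ∸ 1) (a ! ∸ 1) p))
    where
    X = p ∸ 1 + (a ! ∸ 1) * p
    instance
      X≢0 : NonZero X
      X≢0 = >-nonZero (≤-trans (m<n⇒0<n∸m (1<p p-prime)) (m≤m+n (p ∸ 1) _))
    X+1≡a!p : X + 1 ≡ a ! * p
    X+1≡a!p = begin
      X + 1                        ≡⟨ +-comm X 1 ⟩
      suc (p ∸ 1) + (a ! ∸ 1) * p  ≡⟨ cong (_+ (a ! ∸ 1) * p) 1+[p∸1]≡p ⟩
      suc (a ! ∸ 1) * p            ≡⟨ cong (_* p) (m+[n∸m]≡n (>-nonZero⁻¹ (a !) {{a !≢0}})) ⟩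
      a ! * p                      ∎
      where open ≡-Reasoning
    above : ∃[ q ] (Prime q × q ∣ X × ∃[ L ] q ^ L ≡ₚ p ∸ 1) →
            ∃[ q ] (Prime q × a < q × ∃[ L ] q ^ L ≡ₚ p ∸ 1)
    above (q , q-prime , q∣X , L , qᴸ≡-1) = q , q-prime , a<q , L , qᴸ≡-1
      where
      a<q : a < q
      a<q with a <? q
      ... | yes a<q = a<q
      ... | no a≮q = contradiction (∣m+n∣m⇒∣n (subst (q ∣_) (sym X+1≡a!p) q∣a!p) q∣X) (prime∤1 q-prime)
        where
        q∣a!p : q ∣ a ! * p
        q∣a!p = ∣-trans (∣-trans (n∣n! q {{prime⇒nonZero q-prime}}) (m≤n⇒m!∣n! (≮⇒≥ a≮q))) (m∣m*n p)

  ∃t,k-without-carry : ∀ {q L a} b → p ∤ a → q ^ L ≡ₚ p ∸ 1 →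
             ∃[ t ] ∃[ k ] (0 < k × t ≤ p × p ∣ 1 + t * q ^ k × b * t % p ≤ a * t % p)
  ∃t,k-without-carry {L = zero} _ _ 1≡-1 = contradiction 1≡-1 1≢ₚp∸1
  ∃t,k-without-carry {q} {L@(suc _)} {a} b p∤a qᴸ≡-1 with b % p ≤? a % p
  ... | yes b%p≤a%p = 1 , L , z<s , <⇒≤ (1<p p-prime) ,
    subst (λ y → p ∣ 1 + y) (sym (*-identityˡ (q ^ L))) (≡ₚp∸1⇒p∣1+ qᴸ≡-1) ,
    subst₂ (λ u v → u % p ≤ v % p) (sym (*-identityʳ b)) (sym (*-identityʳ a)) b%p≤a%p
  ... | no b%p≰a%p = p ∸ 1 , L + L , z<s , m∸n≤m p 1 , ≡ₚp∸1⇒p∣1+ [p∸1]q²ᴸ≡-1 , (begin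
    b * (p ∸ 1) % p ≡⟨ x[p∸1]%p≡p∸x%p b (<-≤-trans z<s a%p<b%p) ⟩
    p ∸ b % p       ≤⟨ ∸-monoʳ-≤ p (<⇒≤ a%p<b%p) ⟩
    p ∸ a % p       ≡⟨ x[p∸1]%p≡p∸x%p a 0<a%p ⟨
    a * (p ∸ 1) % p ∎)
    where
    open ≤-Reasoning
    a%p<b%p : a % p < b % p
    a%p<b%p = ≰⇒> b%p≰a%p
    0<a%p : 0 < a % p
    0<a%p = n≢0⇒n>0 (λ a%p≡0 → p∤a (m%n≡0⇒n∣m a p a%p≡0))
    q²ᴸ≡1 : q ^ (L + L) ≡ₚ 1
    q²ᴸ≡1 = trans (cong (_% p) (^-distribˡ-+-* q L L)) (trans (≡ₚ-* qᴸ≡-1 qᴸ≡-1) [p∸1]²≡ₚ1)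
    [p∸1]q²ᴸ≡-1 : (p ∸ 1) * q ^ (L + L) ≡ₚ p ∸ 1
    [p∸1]q²ᴸ≡-1 = trans (≡ₚ-* {p ∸ 1} refl q²ᴸ≡1) (cong (_% p) (*-identityʳ (p ∸ 1)))

odd-prime⇒2<p : ∀ {p} → Prime p → p % 2 ≡ 1 → 2 < p
odd-prime⇒2<p p-prime p-odd with m≤n⇒m<n∨m≡n (1<p p-prime)
... | inj₁ 2<p = 2<p
... | inj₂ refl = contradiction p-odd λ ()

mainTheorem1 : (p : ℕ) → Prime p → p % 2 ≡ 1 →
    ¬ (∃[ a ] ∃[ b ] (0 < b × b < a × ¬ (p ∣ a) ×
        ((n : ℕ) → 1 ≤ n → (p * n ∸ 1) ∣ ((a * n) C (b * n)))))
mainTheorem1 p p-prime p-odd (a , b , _ , b<a , p∤a , pn∸1∣C) =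
  let open OddPrime p-prime (odd-prime⇒2<p p-prime p-odd)
      instance p≢0 = prime⇒nonZero p-prime
      q , q-prime , a<q , L , qᴸ≡-1 = ∃prime>-with-neg-power a
      t , k , 0<k , t≤p , p∣1+tqᵏ , noCarry = ∃t,k-without-carry {q} {L} b p∤a qᴸ≡-1
      n , 1≤n , pn∸1∤C = ∃n[pn∸1∤[an]C[bn]] q-prime 0<k b<a a<q t≤p p∣1+tqᵏ noCarry
  in pn∸1∤C (pn∸1∣C n 1≤n)
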